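{- Let $(D,\sqsubseteq,\oplus,\mathcal B)$ be an interpretation monoid and let $(\alpha,\gamma)$ be a Galois insertion of $D$ into $(A,\sqsubseteq_A)$. Then: (1) the set $\alpha(\mathcal B)=\{\alpha(p)\mid p\in\mathcal B\}$ is a basis for $A$; (2) if $X\subseteq A$ is dense in $A$ with respect to the basis $\alpha(\mathcal B)$, then $\gamma(X)=\{\gamma(a)\mid a\in X\}$ is dense in $D$ with respect to the basis $\mathcal B$.
   Context: Let $(D,\sqsubseteq)$ be a complete lattice with join $\sqcup$, bottom $\bot$. A (join) basis of a complete lattice $L$ is a subset $\mathcal B\subseteq L$ such that every $d\in L$ equals the join of $\{b\in\mathcal B\mid b\sqsubseteq d\}$; it is pointed if $\bot\in\mathcal B$. A subset $X\subseteq L$ is dense with respect to a basis $\mathcal B$ if for every $b\in\mathcal B$ with $b\sqsubseteq\bigsqcup X$ there is $x\in X$ with $b\sqsubseteq x$. For $X\subseteq D$, $\downarrow X=\{d\mid\exists x\in X.\ d\sqsubseteq x\}$; the weight of $d$ w.r.t. $\mathcal B$ is $w(d)=\min\{|Y|:Y\subseteq\mathcal B_d,\downarrow Y=\downarrow\mathcal B_d\}$ with $\mathcal B_d=\{b\in\mathcal B\mid b\sqsubseteq d\}$, and $w(X)=\sup_{d\in X}w(d)$. A complete monoid $(M,\oplus)$ assigns to every family $(m_i)_{i\in I}$ ($I$ arbitrary) an element $\bigoplus_{i\in I}m_i$ with $\bigoplus_{i\in\{j\}}m_i=m_j$ and $\bigoplus_{i\in I}m_i=\bigoplus_{j\in J}\bigoplus_{i\in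 I_j}m_i$ for every partition $(I_j)_{j\in J}$ of $I$; $\langle S\rangle$ denotes the least complete submonoid containing $S$; an ordered complete monoid is a complete monoid with a partial order for which $\oplus$ is monotone. For a cardinal $\kappa$, a $\kappa$-quantale is an ordered complete monoid in which every subset of cardinality $\le\kappa$ has a join and $\bigoplus_{i\in I}\bigsqcup_{j\in J_i}x_{i,j}=\bigsqcup_{\beta}\bigoplus_{i\in I}x_{i,\beta(i)}$ for all index sets $I$, nonempty $J_i$ with $|J_i|\le\kappa$ ($\beta$ ranging over functions with $\beta(i)\in J_i$, the right-hand join required to exist). An interpretation monoid $(D,\sqsubseteq,\oplus,\mathcal B)$: $(D,\sqsubseteq,\oplus)$ ordered complete monoid, $(D,\sqsubseteq)$ complete lattice, $\mathcal B$ pointed basis, $\langle\mathcal B\rangle$ a $\kappa_D$-quantale with $\kappa_D=w(\langle\mathcal B\rangle)$. A Galois insertion consists of monotone maps $\alpha:D\to A$, $\gamma:A\to D$ into a poset $(A,\sqsubseteq_A)$ with $\alpha(h)\sqsubseteq_A a\iff h\sqsubseteq\gamma(a)$ for all $h,a$, and $\alpha$ surjective (so $A$ is a complete lattice and $\alpha$ preserves joins). -}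

module Defs where

open import Level using (Level; _⊔_; suc)
open import Data.Product using (Σ; ∃; _×_; _,_; proj₁)
open import Data.Empty.Polymorphic using (⊥)
open import Relation.Binary.PropositionalEquality using (_≡_)
open import Relation.Binary.Structures using (IsPartialOrder)
open import Function.Definitions using (Injective)

module _ {a r : Level} {A : Set a} (_≤_ : A → A → Set r) where

  UpperBound : ∀ {p} → (A → Set p) → A → Set (a ⊔ r ⊔ p)
  UpperBound S u = ∀ x → S x → x ≤ u

  IsLub : ∀ {p} → (A → Set p) → A → Set (a ⊔ r ⊔ p)
  IsLub S u = UpperBound S u × (∀ v → UpperBound S v → u ≤ v)

  IsJoinIn : ∀ {q p} → (A → Set q) → (A → Set p) → A → Set (a ⊔ r ⊔ p ⊔ q)
  IsJoinIn P S u = P u × UpperBound S u × (∀ v → P v → UpperBound S v → u ≤ v)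

  IsBasis : ∀ {p} → (A → Set p) → Set (a ⊔ r ⊔ p)
  IsBasis B = ∀ d → IsLub (λ b → B b × b ≤ d) d

  -- X is dense w.r.t. basis B (the join of X taken as any lub of X)
  IsDense : ∀ {p q} → (A → Set p) → (A → Set q) → Set (a ⊔ r ⊔ p ⊔ q)
  IsDense B X = ∀ b → B b → ∀ s → IsLub X s → b ≤ s → ∃ λ x → X x × b ≤ x

-- cardinality comparison |X| ≤ |Y| : existence of an injection
_≼_ : ∀ {a b} → Set a → Set b → Set (a ⊔ b)
X ≼ Y = Σ (X → Y) (Injective _≡_ _≡_)

Image : ∀ {a b p} {A : Set a} {B : Set b} → (A → B) → (A → Set p) → B → Set (a ⊔ b ⊔ p)
Image f S y = ∃ λ x → S x × f x ≡ y

record PreInterp (ℓ : Level) : Set (suc ℓ) where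
  field
    Carrier        : Set ℓ
    _⊑_            : Carrier → Carrier → Set ℓ
    isPartialOrder : IsPartialOrder _≡_ _⊑_
    ⨆              : (Carrier → Set ℓ) → Carrier
    ⨆-lub          : ∀ S → IsLub _⊑_ S (⨆ S)
    ⊕              : (I : Set ℓ) → (I → Carrier) → Carrier
    ⊕-singleton    : ∀ (I : Set ℓ) (j : I) → (∀ i → i ≡ j) → ∀ m → ⊕ I m ≡ m j
    -- partition law: the partition of I is given by the blocks (fibres) of f : I → J
    ⊕-partition    : ∀ (I J : Set ℓ) (f : I → J) (m : I → Carrier) →
                     ⊕ I m ≡ ⊕ J (λ j → ⊕ (Σ I (λ i → f i ≡ j)) (λ p → m (proj₁ p)))
    ⊕-mono         : ∀ (I : Set ℓ) (m n : I → Carrier) → (∀ i → m i ⊑ n i) → ⊕ I m ⊑ ⊕ I n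
    B              : Carrier → Set ℓ
    B-basis        : IsBasis _⊑_ B
    B-pointed      : B (⨆ (λ _ → ⊥))

module _ {ℓ : Level} (P : PreInterp ℓ) where
  open PreInterp P

  -- ⟨B⟩ : least complete submonoid containing B
  data Gen : Carrier → Set (suc ℓ) where
    base : ∀ {b} → B b → Gen b
    sum  : ∀ (I : Set ℓ) (m : I → Carrier) → (∀ i → Gen (m i)) → Gen (⊕ I m)

  Below : Carrier → Carrier → Set ℓ
  Below d b = B b × b ⊑ d

  Down : (Carrier → Set ℓ) → Carrier → Set ℓ
  Down X e = ∃ λ x → X x × e ⊑ x

  -- w(d) ≤ |L| : some Y ⊆ B_d with ↓Y = ↓B_d has |Y| ≤ |L|
  WeightLe : Carrier → Set ℓ → Set (suc ℓ)
  WeightLe d L = ∃ λ (Y : Carrier → Set ℓ) →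
                   (∀ y → Y y → Below d y) ×
                   (∀ e → (Down Y e → Down (Below d) e) × (Down (Below d) e → Down Y e)) ×
                   (Σ Carrier Y ≼ L)

  -- |J| ≤ κ_D where κ_D = w(⟨B⟩) = sup { w(d) | d ∈ ⟨B⟩ }:
  -- |J| ≤ |L| for every L with w(d) ≤ |L| for all d ∈ ⟨B⟩
  CardLeκ : Set ℓ → Set (suc ℓ)
  CardLeκ J = ∀ (L : Set ℓ) → (∀ d → Gen d → WeightLe d L) → J ≼ L

  record IsKappaQuantale : Set (suc ℓ) where
    field
      joins : ∀ (S : Carrier → Set ℓ) → (∀ x → S x → Gen x) → CardLeκ (Σ Carrier S) →
              ∃ λ u → IsJoinIn _⊑_ Gen S u
      distrib : ∀ (I : Set ℓ) (J : I → Set ℓ) → (∀ i → J i) → (∀ i → CardLeκ (J i)) →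
                (x : (i : I) → J i → Carrier) → (∀ i j → Gen (x i j)) →
                (s : I → Carrier) → (∀ i → IsJoinIn _⊑_ Gen (λ y → ∃ λ j → y ≡ x i j) (s i)) →
                IsJoinIn _⊑_ Gen
                  (λ y → ∃ λ (β : (i : I) → J i) → y ≡ ⊕ I (λ i → x i (β i)))
                  (⊕ I s)

record InterpretationMonoid (ℓ : Level) : Set (suc ℓ) where
  field
    pre       : PreInterp ℓ
    quantale  : IsKappaQuantale pre
  open PreInterp pre public

record GaloisInsertion {ℓ : Level} (D : InterpretationMonoid ℓ)
                       (A : Set ℓ) (_≤A_ : A → A → Set ℓ) : Set ℓ where
  open InterpretationMonoid D
  field
    α       : Carrier → A
    γ       : A → Carrier
    α-mono  : ∀ {h h'} → h ⊑ h' → α h ≤A α h'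
    γ-mono  : ∀ {a a'} → a ≤A a' → γ a ⊑ γ a'
    adj     : ∀ h a → (α h ≤A a → h ⊑ γ a) × (h ⊑ γ a → α h ≤A a)
    α-surj  : ∀ a → ∃ λ h → α h ≡ a

{-# OPTIONS --safe #-}
-- The abstraction α is a left adjoint, so it carries the join h = ⨆ B_h to
-- α h = ⨆ α(B_h); surjectivity of α makes every a ∈ A such an α h, whence α(B)
-- is a basis.  Since α ∘ γ is the identity up to the order, the join of X in A is
-- α (⨆ γ(X)); so b ⊑ ⨆ γ(X) gives α b ≤ ⨆ X, density gives α b ≤ x for some
-- x ∈ X, and the adjunction turns this back into b ⊑ γ x.
module Submission where

open import Defs
open import Level using (Level)
open import Data.Product using (∃; _×_; _,_; proj₁; proj₂)
open import Relation.Binary.Core using (Rel)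
open import Relation.Binary.PropositionalEquality using (_≡_; refl)
open import Relation.Binary.Structures using (IsPreorder; IsPartialOrder)

isLub-of-bounded-superset : ∀ {a r p q} {A : Set a} {_≤_ : Rel A r}
                            {S : A → Set p} {T : A → Set q} {u : A} →
                            IsLub _≤_ S u → (∀ x → S x → T x) → UpperBound _≤_ T u →
                            IsLub _≤_ T u
isLub-of-bounded-superset (_ , least) S⊆T T≤u =
  T≤u , λ v T≤v → least v (λ x Sx → T≤v x (S⊆T x Sx))

module GaloisConnection
  {c a r s} {C : Set c} {A : Set a} {_⊑_ : Rel C r} {_≤_ : Rel A s}
  {α : C → A} {γ : A → C}
  (α-mono : ∀ {h h'} → h ⊑ h' → α h ≤ α h')
  (γ-mono : ∀ {x y} → x ≤ y → γ x ⊑ γ y)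
  (adj : ∀ h x → (α h ≤ x → h ⊑ γ x) × (h ⊑ γ x → α h ≤ x))
  where

  α≤⇒⊑γ : ∀ {h x} → α h ≤ x → h ⊑ γ x
  α≤⇒⊑γ {h} {x} = proj₁ (adj h x)

  ⊑γ⇒α≤ : ∀ {h x} → h ⊑ γ x → α h ≤ x
  ⊑γ⇒α≤ {h} {x} = proj₂ (adj h x)

  α-preserves-lub : ∀ {p} {S : C → Set p} {u : C} →
                    IsLub _⊑_ S u → IsLub _≤_ (Image α S) (α u)
  α-preserves-lub (S≤u , least) =
    (λ { _ (h , Sh , refl) → α-mono (S≤u h Sh) }) ,
    λ v αS≤v → ⊑γ⇒α≤ (least (γ v) (λ h Sh → α≤⇒⊑γ (αS≤v (α h) (h , Sh , refl))))

  module Insertion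
    (≤-isPreorder : IsPreorder _≡_ _≤_)
    (α-surj : ∀ x → ∃ λ h → α h ≡ x)
    where

    open IsPreorder ≤-isPreorder using () renaming (refl to ≤-refl; trans to ≤-trans)

    ≤αγ : ∀ x → x ≤ α (γ x)
    ≤αγ x with α-surj x
    ... | h , refl = α-mono (α≤⇒⊑γ ≤-refl)

    α-image-basis : ∀ {p} {B : C → Set p} → IsBasis _⊑_ B → IsBasis _≤_ (Image α B)
    α-image-basis B-basis x with α-surj x
    ... | h , refl = isLub-of-bounded-superset (α-preserves-lub (B-basis h))
                       (λ { _ (b , (Bb , b⊑h) , refl) → (b , Bb , refl) , α-mono b⊑h })
                       (λ _ → proj₂)

    α-lub-of-γ-image : ∀ {p} {X : A → Set p} {u : C} →
                       IsLub _⊑_ (Image γ X) u → IsLub _≤_ X (α u)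
    α-lub-of-γ-image (γX≤u , least) =
      (λ x Xx → ≤-trans (≤αγ x) (α-mono (γX≤u (γ x) (x , Xx , refl)))) ,
      λ v X≤v → ⊑γ⇒α≤ (least (γ v) λ { _ (x , Xx , refl) → γ-mono (X≤v x Xx) })

    γ-image-dense : ∀ {p q} {B : C → Set p} {X : A → Set q} →
                    IsDense _≤_ (Image α B) X → IsDense _⊑_ B (Image γ X)
    γ-image-dense X-dense b Bb u u-lub b⊑u
      with X-dense (α b) (b , Bb , refl) (α u) (α-lub-of-γ-image u-lub) (α-mono b⊑u)
    ... | x , Xx , αb≤x = γ x , (x , Xx , refl) , α≤⇒⊑γ αb≤x

lemma4p1 : ∀ {ℓ : Level} (D : InterpretationMonoid ℓ) (A : Set ℓ) (_≤A_ : A → A → Set ℓ) →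
           IsPartialOrder _≡_ _≤A_ → (G : GaloisInsertion D A _≤A_) →
           IsBasis _≤A_ (Image (GaloisInsertion.α G) (InterpretationMonoid.B D))
           × (∀ (X : A → Set ℓ) →
                IsDense _≤A_ (Image (GaloisInsertion.α G) (InterpretationMonoid.B D)) X →
                ∀ b → InterpretationMonoid.B D b →
                InterpretationMonoid._⊑_ D b
                  (InterpretationMonoid.⨆ D (Image (GaloisInsertion.γ G) X)) →
                ∃ λ x → Image (GaloisInsertion.γ G) X x × InterpretationMonoid._⊑_ D b x)
lemma4p1 D A _≤A_ ≤A-isPartialOrder G =
  α-image-basis B-basis ,
  λ X X-dense b Bb → γ-image-dense X-dense b Bb _ (⨆-lub (Image γ X))
  where
  open InterpretationMonoid D
  open GaloisInsertion G
  open GaloisConnection (λ {h h′} → α-mono {h} {h′}) (λ {x y} → γ-mono {x} {y}) adj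
  open Insertion (IsPartialOrder.isPreorder ≤A-isPartialOrder) α-surj
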